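{- Let $\mathbf{M}$ be a one-sorted structure, $A$ a commutative semiring, $\mathcal{C}$ a full subcategory of $\operatorname{Def}(\mathbf{M})$ satisfying (a), (b), (c) and having an object with more than one element, and $\mu$ an $A$-valued semi-Fubini measure on $\mathcal{C}$. Let $f:X\to Y$ be a $\mathcal{C}$-morphism, and let $X$ be the disjoint union of definable $X_1,X_2\subseteq X$. Suppose that for $i=1,2$ we have $\mu(X_i)=\sum_a a\,\mu(Y_{i,a})$, where $Y_{i,a}=\{y\in Y:\mu(f^{ -1}(y)\cap X_i)=a\}$. Then $\mu(X)=\sum_a a\,\mu(Y_a)$, where $Y_a=\{y\in Y:\mu(f^{ -1}(y))=a\}$.
   Context: "Definable" means definable in $\mathbf{M}$ with parameters; $\operatorname{Def}(\mathbf{M})$ has as objects the definable $X\subseteq M^m$ ($m$ part of the data) and as morphisms the definable maps. Conditions on $\mathcal{C}$: (a) if objects $X,Y\subseteq M^m$ then $X\cup Y$ is an object; (b) definable subsets of objects are objects; (c) products of objects are objects. $A$ is a commutative semiring (commutative monoid under $+$ and $\cdot$, distributive, $0\cdot a=0$). An $A$-valued semi-Fubini measure on $\mathcal{C}$ is $\mu:\mathrm{Ob}(\mathcal{C})\to A$ with $\mu(\emptyset)=0$, $\mu(\text{singleton})=1$, $\mu(X\cup Y)=\mu(X)+\mu(Y)$ for disjoint objects $X,Y\subseteq M^m$, $\mu(X)=\mu(Y)$ for $\mathcal{C}$-isomorphic objects, and such that every $\mathcal{C}$-morphism $f:X\to Y$ satisfies (F1) $\{\mu(f^{ -1}(y)):y\in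 Y\}$ is finite and (F2) $\{y:\mu(f^{ -1}(y))=a\}$ is definable for each $a\in A$. (Applied to the restrictions $f|_{X_i}$, these make the sums above finite sums of values of $\mu$ on definable sets.) -}

module Defs where

open import Level using (0ℓ)
open import Data.Nat using (ℕ; zero; suc) renaming (_+_ to _+ℕ_)
open import Data.Fin using (Fin)
open import Data.Vec using (Vec; []; _∷_; lookup; _++_; take; drop)
open import Data.List using (List; []; _∷_)
open import Data.List.Relation.Unary.Any using (Any)
open import Data.List.Relation.Unary.All using (All)
open import Data.List.Relation.Unary.AllPairs using (AllPairs)
open import Data.Product using (Σ; ∃; _×_; _,_)
open import Data.Sum using (_⊎_)
open import Data.Empty using (⊥)
open import Data.Unit using (⊤)
open import Relation.Nullary using (¬_)
open import Relation.Binary.PropositionalEquality using (_≡_; _≢_)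
open import Function.Bundles using (_⇔_)
open import Algebra.Bundles using (CommutativeSemiring)

record Signature : Set₁ where
  field
    FunSym : ℕ → Set
    RelSym : ℕ → Set

module _ (Σᴸ : Signature) where
  open Signature Σᴸ

  data Term (k : ℕ) : Set where
    var : Fin k → Term k
    app : ∀ {n} → FunSym n → Vec (Term k) n → Term k

  data Formula : ℕ → Set where
    falsum : ∀ {k} → Formula k
    _≐_    : ∀ {k} → Term k → Term k → Formula k
    rel    : ∀ {k n} → RelSym n → Vec (Term k) n → Formula k
    _⇒_    : ∀ {k} → Formula k → Formula k → Formula k
    _∧_    : ∀ {k} → Formula k → Formula k → Formula k
    _∨_    : ∀ {k} → Formula k → Formula k → Formula k
    all    : ∀ {k} → Formula (suc k) → Formula k
    ex     : ∀ {k} → Formula (suc k) → Formula k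

record Structure (Σᴸ : Signature) : Set₁ where
  open Signature Σᴸ
  field
    M    : Set
    funI : ∀ {n} → FunSym n → Vec M n → M
    relI : ∀ {n} → RelSym n → Vec M n → Set

module _ {Σᴸ : Signature} (𝐌 : Structure Σᴸ) where
  open Structure 𝐌

  evalTerm  : ∀ {k} → Vec M k → Term Σᴸ k → M
  evalTerms : ∀ {k n} → Vec M k → Vec (Term Σᴸ k) n → Vec M n
  evalTerm ρ (var i)    = lookup ρ i
  evalTerm ρ (app f ts) = funI f (evalTerms ρ ts)
  evalTerms ρ []       = []
  evalTerms ρ (t ∷ ts) = evalTerm ρ t ∷ evalTerms ρ ts

  -- satisfaction; variable 0 is the innermost bound variable
  Sat : ∀ {k} → Formula Σᴸ k → Vec M k → Set
  Sat falsum     ρ = ⊥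
  Sat (s ≐ t)    ρ = evalTerm ρ s ≡ evalTerm ρ t
  Sat (rel R ts) ρ = relI R (evalTerms ρ ts)
  Sat (φ ⇒ ψ)    ρ = Sat φ ρ → Sat ψ ρ
  Sat (φ ∧ ψ)    ρ = Sat φ ρ × Sat ψ ρ
  Sat (φ ∨ ψ)    ρ = Sat φ ρ ⊎ Sat ψ ρ
  Sat (all φ)    ρ = (a : M) → Sat φ (a ∷ ρ)
  Sat (ex φ)     ρ = Σ M λ a → Sat φ (a ∷ ρ)

  Pred : ℕ → Set₁
  Pred m = Vec M m → Set

  Definable : ∀ {m} → Pred m → Set
  Definable {m} X =
    Σ ℕ λ k → Σ (Formula Σᴸ (m +ℕ k)) λ φ → Σ (Vec M k) λ ps →
      ∀ x → X x ⇔ Sat φ (x ++ ps)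

  _⊆_ : ∀ {m} → Pred m → Pred m → Set
  X ⊆ Y = ∀ x → X x → Y x

  _∪_ : ∀ {m} → Pred m → Pred m → Pred m
  (X ∪ Y) x = X x ⊎ Y x

  Disjoint : ∀ {m} → Pred m → Pred m → Set
  Disjoint X Y = ∀ x → X x → Y x → ⊥

  ∅ : ∀ {m} → Pred m
  ∅ _ = ⊥

  _⊠_ : ∀ {m n} → Pred m → Pred n → Pred (m +ℕ n)
  _⊠_ {m} X Y z = X (take m z) × Y (drop m z)

  -- A definable map X → Y (X ⊆ M^m, Y ⊆ M^n), given by its graph
  -- G ⊆ M^(m+n), where G (x ++ y) means f(x) = y.
  record DefMap {m n} (X : Pred m) (Y : Pred n) : Set₁ where
    field
      graph      : Pred (m +ℕ n)
      definable  : Definable graph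
      into       : ∀ (x : Vec M m) (y : Vec M n) → graph (x ++ y) → X x × Y y
      total      : ∀ x → X x → Σ (Vec M n) λ y → graph (x ++ y)
      functional : ∀ (x : Vec M m) (y y′ : Vec M n) → graph (x ++ y) → graph (x ++ y′) → y ≡ y′

    fibre : Vec M n → Pred m
    fibre y x = graph (x ++ y)

  open DefMap public

  -- categorical isomorphism: g ∘ f = id_X and f ∘ g = id_Y
  Isomorphic : ∀ {m n} → Pred m → Pred n → Set₁
  Isomorphic {m} {n} X Y = Σ (DefMap X Y) λ f → Σ (DefMap Y X) λ g →
      (∀ (x : Vec M m) (y : Vec M n) x′ → X x → graph f (x ++ y) → graph g (y ++ x′) → x′ ≡ x)
    × (∀ (y : Vec M n) (x : Vec M m) y′ → Y y → graph g (y ++ x) → graph f (x ++ y′) → y′ ≡ y)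

  record FullSubcat : Set₁ where
    field
      Obj        : ∀ {m} → Pred m → Set
      obj-def    : ∀ {m} {X : Pred m} → Obj X → Definable X
      closed-∪   : ∀ {m} {X Y : Pred m} → Obj X → Obj Y → Obj (X ∪ Y)          -- (a)
      closed-sub : ∀ {m} {X Z : Pred m} → Obj X → Definable Z → Z ⊆ X → Obj Z  -- (b)
      closed-×   : ∀ {m n} {X : Pred m} {Y : Pred n} → Obj X → Obj Y → Obj (X ⊠ Y) -- (c)

  HasObjWithTwoElements : FullSubcat → Set₁
  HasObjWithTwoElements C = Σ ℕ λ m → Σ (Pred m) λ X →
    FullSubcat.Obj C X × Σ (Vec M m) λ x → Σ (Vec M m) λ y → X x × X y × x ≢ y

  module _ (C : FullSubcat) (A : CommutativeSemiring 0ℓ 0ℓ) where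
    open FullSubcat C
    open CommutativeSemiring A renaming (Carrier to |A|; _+_ to _+ᴬ_; _*_ to _*ᴬ_)

    -- C-morphisms: definable maps between objects (C is full)
    Morphism : ∀ {m n} → Pred m → Pred n → Set₁
    Morphism X Y = Obj X × Obj Y × DefMap X Y

    record SemiFubini : Set₁ where
      field
        μ          : ∀ {m} → Pred m → |A|
        μ-∅        : ∀ {m} → μ (∅ {m}) ≈ 0#
        μ-single   : ∀ {m} (a : Vec M m) → Obj (λ x → x ≡ a) → μ (λ x → x ≡ a) ≈ 1#
        μ-additive : ∀ {m} {X Y : Pred m} → Obj X → Obj Y → Disjoint X Y →
                     μ (X ∪ Y) ≈ μ X +ᴬ μ Y
        μ-iso      : ∀ {m n} {X : Pred m} {Y : Pred n} → Obj X → Obj Y →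
                     Isomorphic X Y → μ X ≈ μ Y
        F1 : ∀ {m n} {X : Pred m} {Y : Pred n} (f : Morphism X Y) →
             let (_ , _ , g) = f in
             Σ (List |A|) λ L → ∀ y → Y y → Any (λ a → μ (fibre g y) ≈ a) L
        F2 : ∀ {m n} {X : Pred m} {Y : Pred n} (f : Morphism X Y) →
             let (_ , _ , g) = f in
             ∀ a → Definable (λ y → Y y × μ (fibre g y) ≈ a)

    module _ (S : SemiFubini) where
      open SemiFubini S

      Level : ∀ {n} → Pred n → (Vec M n → |A|) → |A| → Pred n
      Level Y v a y = Y y × v y ≈ a

      levelSum : ∀ {n} → Pred n → (Vec M n → |A|) → List |A| → |A|
      levelSum Y v []      = 0#
      levelSum Y v (a ∷ L) = a *ᴬ μ (Level Y v a) +ᴬ levelSum Y v L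

      EnumeratesValues : ∀ {n} → Pred n → (Vec M n → |A|) → List |A| → Set
      EnumeratesValues Y v L =
          AllPairs (λ a b → ¬ (a ≈ b)) L
        × (∀ y → Y y → Any (λ a → v y ≈ a) L)
        × All (λ a → Σ (Vec M _) λ y → Y y × v y ≈ a) L

      -- "s = Σ_a a · μ({y ∈ Y : v(y) = a})", a ranging over the (finite) value set
      IsLevelSum : ∀ {n} → Pred n → (Vec M n → |A|) → |A| → Set
      IsLevelSum Y v s = Σ (List |A|) λ L → EnumeratesValues Y v L × s ≈ levelSum Y v L

      IsLevelSum∀ : ∀ {n} → Pred n → (Vec M n → |A|) → |A| → Set
      IsLevelSum∀ Y v s = ∀ L → EnumeratesValues Y v L → s ≈ levelSum Y v L

module Submission where

-- Write vᵢ(y) = μ(f⁻¹(y) ∩ Xᵢ) and refine Y into the blocks W(b,c) = {v₁ = b} ∩ {v₂ = c}.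
-- A level sum Σₐ a·μ{w = a} equals Σ_{b,c} c_w(b,c)·μ(W(b,c)) whenever w is constant, equal to
-- c_w(b,c), on each block: partition every level set by the blocks and every block by the level
-- sets, and note that a nonempty intersection {w = a} ∩ W(b,c) forces a = c_w(b,c). Additivity of μ
-- on the fibres makes v = v₁ + v₂ equal to b + c on W(b,c), so
--   μX = μX₁ + μX₂ = Σ b·μW(b,c) + Σ c·μW(b,c) = Σ (b + c)·μW(b,c) = Σₐ a·μ(Y_a).
-- The level sets of vᵢ are definable by (F2) applied to the restriction f|Xᵢ. Excluded middle is
-- used to split sets along definable subsets.

open import Defs
open import Level using (0ℓ)
open import Data.Nat using (ℕ; zero; suc) renaming (_+_ to _+ℕ_)
open import Data.Fin using (Fin; zero; suc; _↑ˡ_; _↑ʳ_; splitAt)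
open import Data.Vec using (Vec; []; _∷_; lookup; _++_; take; drop)
open import Data.Vec.Properties
  using (lookup-++ˡ; lookup-++ʳ; lookup-splitAt; take++drop≡id; tabulate-cong; tabulate∘lookup)
open import Data.List using (List; []; _∷_; cartesianProduct)
open import Data.List.Relation.Unary.All using (All; []; _∷_)
open import Data.List.Relation.Unary.AllPairs using (AllPairs; _∷_)
import Data.List.Relation.Unary.AllPairs as AllPairs
open import Data.List.Relation.Unary.Any using (Any; here; there)
import Data.List.Relation.Unary.Any as Any
import Data.List.Relation.Unary.Any.Properties as Any
import Data.List.Relation.Unary.All as All
import Data.List.Relation.Unary.Unique.Setoid.Properties as Unique
open import Algebra.Bundles using (CommutativeSemiring)
open import Data.Product using (_×_; _,_; proj₁; proj₂; swap)
open import Data.Product.Function.NonDependent.Propositional using (_×-⇔_)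
open import Data.Sum using (inj₁; inj₂; [_,_]′)
import Data.Sum as Sum
open import Data.Sum.Function.Propositional using (_⊎-⇔_)
open import Function using (_∘_; id; case_of_)
open import Function.Bundles using (_⇔_; mk⇔; Equivalence)
open import Function.Properties.Equivalence using () renaming (trans to ⇔-trans; sym to ⇔-sym)
open import Function.Related.TypeIsomorphisms using (→-cong-⇔)
open import Relation.Binary.PropositionalEquality as ≡ using (_≡_)
open import Relation.Nullary using (¬_; yes; no)
open import Relation.Nullary.Decidable using (toSum)
open import Axiom.ExcludedMiddle using (ExcludedMiddle)
open import Data.Empty using (⊥-elim)
open import Relation.Unary using (_∩_; ∁; _⊆′_; _≐′_)

module Definability {Σᴸ : Signature} (𝐌 : Structure Σᴸ) where
  open Signature Σᴸ
  open Structure 𝐌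
  open Equivalence using (to; from)
  open ≡ using (refl; sym; trans; cong; cong₂; subst; subst₂)

  liftRen : ∀ {k k′} → (Fin k → Fin k′) → Fin (suc k) → Fin (suc k′)
  liftRen ρ zero    = zero
  liftRen ρ (suc i) = suc (ρ i)

  renameTerm  : ∀ {k k′} → (Fin k → Fin k′) → Term Σᴸ k → Term Σᴸ k′
  renameTerms : ∀ {k k′ n} → (Fin k → Fin k′) → Vec (Term Σᴸ k) n → Vec (Term Σᴸ k′) n
  renameTerm ρ (var i)    = var (ρ i)
  renameTerm ρ (app f ts) = app f (renameTerms ρ ts)
  renameTerms ρ []       = []
  renameTerms ρ (t ∷ ts) = renameTerm ρ t ∷ renameTerms ρ ts

  rename : ∀ {k k′} → (Fin k → Fin k′) → Formula Σᴸ k → Formula Σᴸ k′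
  rename ρ falsum     = falsum
  rename ρ (s ≐ t)    = renameTerm ρ s ≐ renameTerm ρ t
  rename ρ (rel R ts) = rel R (renameTerms ρ ts)
  rename ρ (φ ⇒ ψ)    = rename ρ φ ⇒ rename ρ ψ
  rename ρ (φ ∧ ψ)    = rename ρ φ ∧ rename ρ ψ
  rename ρ (φ ∨ ψ)    = rename ρ φ ∨ rename ρ ψ
  rename ρ (all φ)    = all (rename (liftRen ρ) φ)
  rename ρ (ex φ)     = ex (rename (liftRen ρ) φ)

  record Agree {k k′} (ρ : Fin k → Fin k′) (env′ : Vec M k′) (env : Vec M k) : Set where
    constructor agreeing
    field lookup-agrees : ∀ i → lookup env′ (ρ i) ≡ lookup env i
  open Agree

  agree-∘ : ∀ {k k′ k″} {ρ : Fin k′ → Fin k″} {σ : Fin k → Fin k′} {env″ env′ env} →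
            Agree ρ env″ env′ → Agree σ env′ env → Agree (ρ ∘ σ) env″ env
  agree-∘ {σ = σ} ρ-agrees σ-agrees =
    agreeing λ i → trans (lookup-agrees ρ-agrees (σ i)) (lookup-agrees σ-agrees i)

  agree-lift : ∀ {k k′} {ρ : Fin k → Fin k′} {env′ env} a →
               Agree ρ env′ env → Agree (liftRen ρ) (a ∷ env′) (a ∷ env)
  agree-lift a agrees = agreeing λ where
    zero    → refl
    (suc i) → lookup-agrees agrees i

  agree-++ˡ : ∀ {m n} (x : Vec M m) (y : Vec M n) → Agree (_↑ˡ n) (x ++ y) x
  agree-++ˡ x y = agreeing (lookup-++ˡ x y)

  agree-++ʳ : ∀ {m n} (x : Vec M m) (y : Vec M n) → Agree (m ↑ʳ_) (x ++ y) y
  agree-++ʳ x y = agreeing (lookup-++ʳ x y)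

  copair : ∀ m {n k} → (Fin m → Fin k) → (Fin n → Fin k) → Fin (m +ℕ n) → Fin k
  copair m f g i = [ f , g ]′ (splitAt m i)

  agree-copair : ∀ {m n k} {f : Fin m → Fin k} {g : Fin n → Fin k} {env} (x : Vec M m) (y : Vec M n) →
                 Agree f env x → Agree g env y → Agree (copair m f g) env (x ++ y)
  agree-copair {m} {f = f} {g} {env} x y f-agrees g-agrees = agreeing agrees
    where
    agrees : ∀ i → lookup env (copair m f g i) ≡ lookup (x ++ y) i
    agrees i rewrite lookup-splitAt m x y i with splitAt m i
    ... | inj₁ a = lookup-agrees f-agrees a
    ... | inj₂ b = lookup-agrees g-agrees b

  evalTerm-rename  : ∀ {k k′} {ρ : Fin k → Fin k′} {env′ env} → Agree ρ env′ env →
                     ∀ t → evalTerm 𝐌 env′ (renameTerm ρ t) ≡ evalTerm 𝐌 env t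
  evalTerms-rename : ∀ {k k′ n} {ρ : Fin k → Fin k′} {env′ env} → Agree ρ env′ env →
                     ∀ (ts : Vec (Term Σᴸ k) n) → evalTerms 𝐌 env′ (renameTerms ρ ts) ≡ evalTerms 𝐌 env ts
  evalTerm-rename agrees (var i)    = lookup-agrees agrees i
  evalTerm-rename agrees (app f ts) = cong (funI f) (evalTerms-rename agrees ts)
  evalTerms-rename agrees []       = refl
  evalTerms-rename agrees (t ∷ ts) = cong₂ _∷_ (evalTerm-rename agrees t) (evalTerms-rename agrees ts)

  Sat-rename : ∀ {k k′} {ρ : Fin k → Fin k′} {env′ env} (φ : Formula Σᴸ k) →
               Agree ρ env′ env → Sat 𝐌 (rename ρ φ) env′ ⇔ Sat 𝐌 φ env
  Sat-rename falsum     agrees = mk⇔ id id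
  Sat-rename (s ≐ t)    agrees = mk⇔ (subst₂ _≡_ (evalTerm-rename agrees s) (evalTerm-rename agrees t))
                                     (subst₂ _≡_ (sym (evalTerm-rename agrees s)) (sym (evalTerm-rename agrees t)))
  Sat-rename (rel R ts) agrees = mk⇔ (subst (relI R) (evalTerms-rename agrees ts))
                                     (subst (relI R) (sym (evalTerms-rename agrees ts)))
  Sat-rename (φ ⇒ ψ)    agrees = →-cong-⇔ (Sat-rename φ agrees) (Sat-rename ψ agrees)
  Sat-rename (φ ∧ ψ)    agrees = Sat-rename φ agrees ×-⇔ Sat-rename ψ agrees
  Sat-rename (φ ∨ ψ)    agrees = Sat-rename φ agrees ⊎-⇔ Sat-rename ψ agrees
  Sat-rename (all φ)    agrees = mk⇔ (λ h a → to (Sat-rename φ (agree-lift a agrees)) (h a))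
                                     (λ h a → from (Sat-rename φ (agree-lift a agrees)) (h a))
  Sat-rename (ex φ)     agrees = mk⇔ (λ (a , s) → a , to (Sat-rename φ (agree-lift a agrees)) s)
                                     (λ (a , s) → a , from (Sat-rename φ (agree-lift a agrees)) s)

  defines-rename : ∀ {k k′} {ρ : Fin k → Fin k′} {env′ env} {P : Set} (φ : Formula Σᴸ k) →
                   Agree ρ env′ env → P ⇔ Sat 𝐌 φ env → P ⇔ Sat 𝐌 (rename ρ φ) env′
  defines-rename φ agrees P⇔φ = ⇔-trans P⇔φ (⇔-sym (Sat-rename φ agrees))

  lookup-extensionality : ∀ {n} {u v : Vec M n} → (∀ i → lookup u i ≡ lookup v i) → u ≡ v
  lookup-extensionality {u = u} {v} same =
    trans (sym (tabulate∘lookup u)) (trans (tabulate-cong same) (tabulate∘lookup v))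

  take-++ : ∀ {m n} (x : Vec M m) (y : Vec M n) → take m (x ++ y) ≡ x
  take-++ []      y = refl
  take-++ (a ∷ x) y = cong (a ∷_) (take-++ x y)

  drop-++ : ∀ {m n} (x : Vec M m) (y : Vec M n) → drop m (x ++ y) ≡ y
  drop-++ []      y = refl
  drop-++ (a ∷ x) y = drop-++ x y

  agree-take : ∀ m {n} (z : Vec M (m +ℕ n)) → Agree (_↑ˡ n) z (take m z)
  agree-take m z = agreeing λ a → trans (cong (λ w → lookup w (a ↑ˡ _)) (sym (take++drop≡id m z))) (lookup-++ˡ (take m z) (drop m z) a)

  agree-drop : ∀ m {n} (z : Vec M (m +ℕ n)) → Agree (m ↑ʳ_) z (drop m z)
  agree-drop m z = agreeing λ b → trans (cong (λ w → lookup w (m ↑ʳ b)) (sym (take++drop≡id m z))) (lookup-++ʳ (take m z) (drop m z) b)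

  definable-resp : ∀ {m} {P Q : Pred 𝐌 m} → P ≐′ Q → Definable 𝐌 P → Definable 𝐌 Q
  definable-resp (P⊆Q , Q⊆P) (k , φ , ps , P⇔φ) = k , φ , ps , λ x → ⇔-trans (mk⇔ (Q⊆P x) (P⊆Q x)) (P⇔φ x)

  definable-∁ : ∀ {m} {P : Pred 𝐌 m} → Definable 𝐌 P → Definable 𝐌 (∁ P)
  definable-∁ (k , φ , ps , P⇔φ) = k , (φ ⇒ falsum) , ps , λ x → →-cong-⇔ (P⇔φ x) (mk⇔ id id)

  definable-∩ : ∀ {m} {P Q : Pred 𝐌 m} → Definable 𝐌 P → Definable 𝐌 Q → Definable 𝐌 (P ∩ Q)
  definable-∩ {m} (k₁ , φ₁ , ps₁ , P⇔φ₁) (k₂ , φ₂ , ps₂ , Q⇔φ₂) =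
    k₁ +ℕ k₂ , (rename ρ₁ φ₁ ∧ rename ρ₂ φ₂) , ps₁ ++ ps₂ , λ x →
      defines-rename φ₁ (agrees₁ x) (P⇔φ₁ x) ×-⇔ defines-rename φ₂ (agrees₂ x) (Q⇔φ₂ x)
    where
    ρ₁ : Fin (m +ℕ k₁) → Fin (m +ℕ (k₁ +ℕ k₂))
    ρ₁ = copair m (_↑ˡ (k₁ +ℕ k₂)) ((m ↑ʳ_) ∘ (_↑ˡ k₂))
    ρ₂ : Fin (m +ℕ k₂) → Fin (m +ℕ (k₁ +ℕ k₂))
    ρ₂ = copair m (_↑ˡ (k₁ +ℕ k₂)) ((m ↑ʳ_) ∘ (k₁ ↑ʳ_))
    agrees₁ : ∀ x → Agree ρ₁ (x ++ (ps₁ ++ ps₂)) (x ++ ps₁)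
    agrees₁ x = agree-copair x ps₁ (agree-++ˡ x _) (agree-∘ (agree-++ʳ x _) (agree-++ˡ ps₁ ps₂))
    agrees₂ : ∀ x → Agree ρ₂ (x ++ (ps₁ ++ ps₂)) (x ++ ps₂)
    agrees₂ x = agree-copair x ps₂ (agree-++ˡ x _) (agree-∘ (agree-++ʳ x _) (agree-++ʳ ps₁ ps₂))

  definable-take : ∀ {m} n {P : Pred 𝐌 m} → Definable 𝐌 P → Definable 𝐌 {m +ℕ n} (λ z → P (take m z))
  definable-take {m} n (k , φ , ps , P⇔φ) = k , rename ρ φ , ps , λ z → defines-rename φ (agrees z) (P⇔φ (take m z))
    where
    ρ : Fin (m +ℕ k) → Fin ((m +ℕ n) +ℕ k)
    ρ = copair m ((_↑ˡ k) ∘ (_↑ˡ n)) ((m +ℕ n) ↑ʳ_)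
    agrees : ∀ z → Agree ρ (z ++ ps) (take m z ++ ps)
    agrees z = agree-copair (take m z) ps (agree-∘ (agree-++ˡ z ps) (agree-take m z)) (agree-++ʳ z ps)

  definable-fibre : ∀ {m n} {G : Pred 𝐌 (m +ℕ n)} → Definable 𝐌 G → (y : Vec M n) →
                    Definable 𝐌 {m} (λ x → G (x ++ y))
  definable-fibre {m} {n} (k , φ , ps , G⇔φ) y =
    n +ℕ k , rename ρ φ , y ++ ps , λ x → defines-rename φ (agrees x) (G⇔φ (x ++ y))
    where
    ρ : Fin ((m +ℕ n) +ℕ k) → Fin (m +ℕ (n +ℕ k))
    ρ = copair (m +ℕ n) (copair m (_↑ˡ (n +ℕ k)) ((m ↑ʳ_) ∘ (_↑ˡ k))) ((m ↑ʳ_) ∘ (n ↑ʳ_))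
    agrees : ∀ x → Agree ρ (x ++ (y ++ ps)) ((x ++ y) ++ ps)
    agrees x = agree-copair (x ++ y) ps
      (agree-copair x y (agree-++ˡ x _) (agree-∘ (agree-++ʳ x _) (agree-++ˡ y ps)))
      (agree-∘ (agree-++ʳ x _) (agree-++ʳ y ps))

  equalities : ∀ {m k} → (Fin m → Fin k) → (Fin m → Fin k) → Formula Σᴸ k
  equalities {zero}  f g = falsum ⇒ falsum
  equalities {suc m} f g = (var (f zero) ≐ var (g zero)) ∧ equalities (f ∘ suc) (g ∘ suc)

  Sat-equalities : ∀ {m k} (f g : Fin m → Fin k) env →
                   Sat 𝐌 (equalities f g) env ⇔ (∀ a → lookup env (f a) ≡ lookup env (g a))
  Sat-equalities {zero}  f g env = mk⇔ (λ _ ()) (λ _ → id)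
  Sat-equalities {suc m} f g env = mk⇔
    (λ { (e , s) zero → e ; (e , s) (suc a) → to (Sat-equalities (f ∘ suc) (g ∘ suc) env) s a })
    (λ same → same zero , from (Sat-equalities (f ∘ suc) (g ∘ suc) env) (same ∘ suc))

  definable-diagonal : ∀ m → Definable 𝐌 {m +ℕ m} (λ z → take m z ≡ drop m z)
  definable-diagonal m = 0 , equalities left right , [] , λ z →
      ⇔-trans (diagonal⇔ z) (⇔-sym (Sat-equalities left right (z ++ [])))
    where
    left right : Fin m → Fin ((m +ℕ m) +ℕ 0)
    left  a = (a ↑ˡ m) ↑ˡ 0
    right a = (m ↑ʳ a) ↑ˡ 0
    diagonal⇔ : ∀ z → take m z ≡ drop m z ⇔ (∀ a → lookup (z ++ []) (left a) ≡ lookup (z ++ []) (right a))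
    diagonal⇔ z = mk⇔
      (λ e a → trans (lookup-agrees left≡ a) (trans (cong (λ w → lookup w a) e) (sym (lookup-agrees right≡ a))))
      (λ same → lookup-extensionality λ a →
        trans (sym (lookup-agrees left≡ a)) (trans (same a) (lookup-agrees right≡ a)))
      where
      left≡ : Agree left (z ++ []) (take m z)
      left≡ = agree-∘ (agree-++ˡ z []) (agree-take m z)
      right≡ : Agree right (z ++ []) (drop m z)
      right≡ = agree-∘ (agree-++ˡ z []) (agree-drop m z)

module FiniteSums (A : CommutativeSemiring 0ℓ 0ℓ) where
  open CommutativeSemiring A renaming (Carrier to |A|)
  open import Algebra.Properties.CommutativeSemigroup +-commutativeSemigroup using (interchange)

  sumL : {I : Set} → List I → (I → |A|) → |A|
  sumL []      f = 0#
  sumL (i ∷ K) f = f i + sumL K f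

  module _ {I : Set} where

    sumL-cong : ∀ K {f g : I → |A|} → (∀ i → f i ≈ g i) → sumL K f ≈ sumL K g
    sumL-cong []      f≈g = refl
    sumL-cong (i ∷ K) f≈g = +-cong (f≈g i) (sumL-cong K f≈g)

    sumL-congAll : ∀ {K} {f g : I → |A|} → All (λ i → f i ≈ g i) K → sumL K f ≈ sumL K g
    sumL-congAll []           = refl
    sumL-congAll (fi≈gi ∷ f≈g) = +-cong fi≈gi (sumL-congAll f≈g)

    sumL-zero : ∀ K → sumL {I} K (λ _ → 0#) ≈ 0#
    sumL-zero []      = refl
    sumL-zero (i ∷ K) = trans (+-identityˡ _) (sumL-zero K)

    sumL-+ : ∀ K (f g : I → |A|) → sumL K (λ i → f i + g i) ≈ sumL K f + sumL K g
    sumL-+ []      f g = sym (+-identityʳ 0#)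
    sumL-+ (i ∷ K) f g = trans (+-cong refl (sumL-+ K f g)) (interchange (f i) (g i) _ _)

    sumL-distribˡ : ∀ K c (f : I → |A|) → c * sumL K f ≈ sumL K (λ i → c * f i)
    sumL-distribˡ []      c f = zeroʳ c
    sumL-distribˡ (i ∷ K) c f = trans (distribˡ c (f i) _) (+-cong refl (sumL-distribˡ K c f))

  sumL-swap : ∀ {I J : Set} K L (h : I → J → |A|) →
              sumL K (λ i → sumL L (h i)) ≈ sumL L (λ j → sumL K (λ i → h i j))
  sumL-swap []      L h = sym (sumL-zero L)
  sumL-swap (i ∷ K) L h = trans (+-cong refl (sumL-swap K L h)) (sym (sumL-+ L (h i) _))

module Measure {Σᴸ : Signature} {𝐌 : Structure Σᴸ} {C : FullSubcat 𝐌} {A : CommutativeSemiring 0ℓ 0ℓ}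
               (S : SemiFubini 𝐌 C A) where
  open Structure 𝐌 using (M)
  open Definability 𝐌
  open FullSubcat C
  open CommutativeSemiring A renaming (Carrier to |A|)
  open SemiFubini S
  open FiniteSums A
  open import Relation.Binary.Reasoning.Setoid setoid

  levelSet : ∀ {n} → Pred 𝐌 n → (Vec M n → |A|) → |A| → Pred 𝐌 n
  levelSet = Level 𝐌 C A S

  obj-∩ : ∀ {m} {P Q : Pred 𝐌 m} → Obj P → Definable 𝐌 Q → Obj (P ∩ Q)
  obj-∩ P-obj Q-def = closed-sub P-obj (definable-∩ (obj-def P-obj) Q-def) (λ _ → proj₁)

  obj-fibre : ∀ {m n} {X : Pred 𝐌 m} {Y : Pred 𝐌 n} → Obj X → (f : DefMap 𝐌 X Y) → ∀ y → Obj (fibre f y)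
  obj-fibre X-obj f y = closed-sub X-obj (definable-fibre (definable f) y) (λ x fx≡y → proj₁ (into f x y fx≡y))

  ++-diagonal : ∀ {m} (x y : Vec M m) → take m (x ++ y) ≡ drop m (x ++ y) → x ≡ y
  ++-diagonal x y diag = ≡.trans (≡.sym (take-++ x y)) (≡.trans diag (drop-++ x y))

  inclusion : ∀ {m} {P Q : Pred 𝐌 m} → Definable 𝐌 P → P ⊆′ Q → DefMap 𝐌 P Q
  inclusion {m} {P} {Q} P-def P⊆Q = record
    { graph      = λ z → P (take m z) × take m z ≡ drop m z
    ; definable  = definable-∩ (definable-take m P-def) (definable-diagonal m)
    ; into       = λ x y (p , diag) → let px = ≡.subst P (take-++ x y) p in
                     px , ≡.subst Q (++-diagonal x y diag) (P⊆Q x px)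
    ; total      = λ x px → x , ≡.subst P (≡.sym (take-++ x x)) px , ≡.trans (take-++ x x) (≡.sym (drop-++ x x))
    ; functional = λ x y y′ (_ , diag) (_ , diag′) → ≡.trans (≡.sym (++-diagonal x y diag)) (++-diagonal x y′ diag′)
    }

  -- Predicates with the same points need not be equal; the inclusions between them form a C-isomorphism.
  μ-cong : ∀ {m} {P Q : Pred 𝐌 m} → Obj P → P ≐′ Q → μ P ≈ μ Q
  μ-cong {m} {P} {Q} P-obj (P⊆Q , Q⊆P) =
    μ-iso P-obj Q-obj (inclusion (obj-def P-obj) P⊆Q , inclusion Q-def Q⊆P ,
                       (λ x y x′ _ → round-trip x y x′) , (λ y x y′ _ → round-trip y x y′))
    where
    Q-def = definable-resp (P⊆Q , Q⊆P) (obj-def P-obj)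
    Q-obj = closed-sub P-obj Q-def Q⊆P
    round-trip : ∀ {R′ R″ : Set} (x y x′ : Vec M m) →
                 R′ × take m (x ++ y) ≡ drop m (x ++ y) → R″ × take m (y ++ x′) ≡ drop m (y ++ x′) → x′ ≡ x
    round-trip x y x′ (_ , diag) (_ , diag′) = ≡.sym (≡.trans (++-diagonal x y diag) (++-diagonal y x′ diag′))

  μ-empty : ∀ {m} {P : Pred 𝐌 m} → Obj P → (∀ x → ¬ P x) → μ P ≈ 0#
  μ-empty P-obj empty = trans (μ-cong P-obj (empty , λ _ ())) μ-∅

  μ-∩-comm : ∀ {m} {P Q : Pred 𝐌 m} → Obj (P ∩ Q) → μ (P ∩ Q) ≈ μ (Q ∩ P)
  μ-∩-comm P∩Q-obj = μ-cong P∩Q-obj ((λ _ → swap) , (λ _ → swap))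

  μ-∩-⊆ : ∀ {m} {P Q : Pred 𝐌 m} → Obj P → Definable 𝐌 Q → Q ⊆′ P → μ (P ∩ Q) ≈ μ Q
  μ-∩-⊆ P-obj Q-def Q⊆P = μ-cong (obj-∩ P-obj Q-def) ((λ _ → proj₂) , λ x q → Q⊆P x q , q)

  μ-∩-additive : ∀ {m} {P Q₁ Q₂ : Pred 𝐌 m} → Obj P → Definable 𝐌 Q₁ → Definable 𝐌 Q₂ →
                 Disjoint 𝐌 Q₁ Q₂ → P ⊆′ _∪_ 𝐌 Q₁ Q₂ → μ P ≈ μ (P ∩ Q₁) + μ (P ∩ Q₂)
  μ-∩-additive {P = P} {Q₁} {Q₂} P-obj Q₁-def Q₂-def Q₁#Q₂ P⊆Q₁∪Q₂ =
    trans (μ-cong P-obj (split , λ _ → [ proj₁ , proj₁ ]′))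
          (μ-additive (obj-∩ P-obj Q₁-def) (obj-∩ P-obj Q₂-def) (λ x (_ , q₁) (_ , q₂) → Q₁#Q₂ x q₁ q₂))
    where
    split : P ⊆′ _∪_ 𝐌 (P ∩ Q₁) (P ∩ Q₂)
    split x p = Sum.map (p ,_) (p ,_) (P⊆Q₁∪Q₂ x p)

  levelSum≡sumL : ∀ {n} (Y : Pred 𝐌 n) w K → levelSum 𝐌 C A S Y w K ≡ sumL K (λ a → a * μ (levelSet Y w a))
  levelSum≡sumL Y w []      = ≡.refl
  levelSum≡sumL Y w (a ∷ K) = ≡.cong (_ +_) (levelSum≡sumL Y w K)

  record IsPartition {n} {I : Set} (P : Pred 𝐌 n) (Z : I → Pred 𝐌 n) (K : List I) : Set where
    field
      blocks-definable : ∀ i → Definable 𝐌 (Z i)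
      blocks-disjoint  : AllPairs (λ i j → Disjoint 𝐌 (Z i) (Z j)) K
      blocks-cover     : ∀ x → P x → Any (λ i → Z i x) K
  open IsPartition

  IsPartition-⊆ : ∀ {n} {I : Set} {P Q : Pred 𝐌 n} {Z : I → Pred 𝐌 n} {K} →
                  P ⊆′ Q → IsPartition Q Z K → IsPartition P Z K
  IsPartition-⊆ P⊆Q Z-part = record
    { blocks-definable = blocks-definable Z-part
    ; blocks-disjoint  = blocks-disjoint Z-part
    ; blocks-cover     = λ x p → blocks-cover Z-part x (P⊆Q x p)
    }

  levels-partition : ∀ {n} {Y : Pred 𝐌 n} {w K} → (∀ a → Definable 𝐌 (levelSet Y w a)) →
                     EnumeratesValues 𝐌 C A S Y w K → IsPartition Y (levelSet Y w) K
  levels-partition levels-def (K-unique , K-covers , _) = record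
    { blocks-definable = levels-def
    ; blocks-disjoint  = AllPairs.map (λ a≉b y (_ , wy≈a) (_ , wy≈b) → a≉b (trans (sym wy≈a) wy≈b)) K-unique
    ; blocks-cover     = λ y y∈Y → Any.map (y∈Y ,_) (K-covers y y∈Y)
    }

  common-refinement : ∀ {n} {Y : Pred 𝐌 n} {w₁ w₂ K₁ K₂} →
    (∀ a → Definable 𝐌 (levelSet Y w₁ a)) → EnumeratesValues 𝐌 C A S Y w₁ K₁ →
    (∀ a → Definable 𝐌 (levelSet Y w₂ a)) → EnumeratesValues 𝐌 C A S Y w₂ K₂ →
    IsPartition Y (λ p → levelSet Y w₁ (proj₁ p) ∩ levelSet Y w₂ (proj₂ p)) (cartesianProduct K₁ K₂)
  common-refinement levels₁-def K₁-enum@(K₁-unique , _) levels₂-def K₂-enum@(K₂-unique , _) = record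
    { blocks-definable = λ p → definable-∩ (levels₁-def (proj₁ p)) (levels₂-def (proj₂ p))
    ; blocks-disjoint  = AllPairs.map (λ p≉q y ((_ , e₁) , (_ , e₂)) ((_ , e₁′) , (_ , e₂′)) →
                           p≉q (trans (sym e₁) e₁′ , trans (sym e₂) e₂′))
                         (Unique.cartesianProduct⁺ setoid setoid K₁-unique K₂-unique)
    ; blocks-cover     = λ y y∈Y → Any.cartesianProduct⁺ (blocks-cover (levels-partition levels₁-def K₁-enum) y y∈Y)
                                                          (blocks-cover (levels-partition levels₂-def K₂-enum) y y∈Y)
    }

  restrict : ∀ {m n} {X X′ : Pred 𝐌 m} {Y : Pred 𝐌 n} → DefMap 𝐌 X Y → Definable 𝐌 X′ → X′ ⊆′ X → DefMap 𝐌 X′ Y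
  restrict {m} {n} {X′ = X′} f X′-def X′⊆X = record
    { graph      = λ z → graph f z × X′ (take m z)
    ; definable  = definable-∩ (definable f) (definable-take n X′-def)
    ; into       = λ x y (fx≡y , x∈X′) → ≡.subst X′ (take-++ x y) x∈X′ , proj₂ (into f x y fx≡y)
    ; total      = λ x x∈X′ → let (y , fx≡y) = total f x (X′⊆X x x∈X′) in
                     y , fx≡y , ≡.subst X′ (≡.sym (take-++ x y)) x∈X′
    ; functional = λ x y y′ (fx≡y , _) (fx≡y′ , _) → functional f x y y′ fx≡y fx≡y′
    }

  restricted-levels-definable : ∀ {m n} {X X′ : Pred 𝐌 m} {Y : Pred 𝐌 n} → Obj X → Obj Y →
    (f : DefMap 𝐌 X Y) → Definable 𝐌 X′ → X′ ⊆′ X →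
    ∀ a → Definable 𝐌 (levelSet Y (λ y → μ (fibre f y ∩ X′)) a)
  restricted-levels-definable {X′ = X′} X-obj Y-obj f X′-def X′⊆X a =
    definable-resp ((λ y (y∈Y , e) → y∈Y , trans (fibres≈ y) e) , (λ y (y∈Y , e) → y∈Y , trans (sym (fibres≈ y)) e))
                   (F2 (closed-sub X-obj X′-def X′⊆X , Y-obj , restrict f X′-def X′⊆X) a)
    where
    fibres≈ : ∀ y → μ (fibre f y ∩ X′) ≈ μ (fibre (restrict f X′-def X′⊆X) y)
    fibres≈ y = μ-cong (obj-∩ (obj-fibre X-obj f y) X′-def)
      ( (λ x (fx≡y , x∈X′) → fx≡y , ≡.subst X′ (≡.sym (take-++ x y)) x∈X′)
      , (λ x (fx≡y , x∈X′) → fx≡y , ≡.subst X′ (take-++ x y) x∈X′))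

  μ-fibre-additive : ∀ {m n} {X X₁ X₂ : Pred 𝐌 m} {Y : Pred 𝐌 n} → Obj X → (f : DefMap 𝐌 X Y) →
                     Definable 𝐌 X₁ → Definable 𝐌 X₂ → Disjoint 𝐌 X₁ X₂ → X ⊆′ _∪_ 𝐌 X₁ X₂ →
                     ∀ y → μ (fibre f y) ≈ μ (fibre f y ∩ X₁) + μ (fibre f y ∩ X₂)
  μ-fibre-additive X-obj f X₁-def X₂-def X₁#X₂ X⊆X₁∪X₂ y =
    μ-∩-additive (obj-fibre X-obj f y) X₁-def X₂-def X₁#X₂ (λ x fx≡y → X⊆X₁∪X₂ x (proj₁ (into f x y fx≡y)))

  module Classical (em : ExcludedMiddle 0ℓ) where

    μ-split : ∀ {m} {P Q : Pred 𝐌 m} → Obj P → Definable 𝐌 Q → μ P ≈ μ (P ∩ Q) + μ (P ∩ ∁ Q)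
    μ-split P-obj Q-def = μ-∩-additive P-obj Q-def (definable-∁ Q-def) (λ _ q ¬q → ¬q q) (λ _ _ → toSum em)

    μ-weight-cong : ∀ {m} {P : Pred 𝐌 m} {a b} → Obj P → (∀ x → P x → a ≈ b) → a * μ P ≈ b * μ P
    μ-weight-cong {P = P} {a} {b} P-obj a≈b-on-P with em {a ≈ b}
    ... | yes a≈b = *-congʳ a≈b
    ... | no  a≉b = begin
      a * μ P ≈⟨ *-congˡ μP≈0 ⟩
      a * 0#  ≈⟨ zeroʳ a ⟩
      0#      ≈⟨ zeroʳ b ⟨
      b * 0#  ≈⟨ *-congˡ μP≈0 ⟨
      b * μ P ∎
      where
      μP≈0 = μ-empty P-obj (λ x p → a≉b (a≈b-on-P x p))

    μ-partition : ∀ {n} {I : Set} {P : Pred 𝐌 n} {Z : I → Pred 𝐌 n} {K} → Obj P → IsPartition P Z K →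
                  μ P ≈ sumL K (λ i → μ (P ∩ Z i))
    μ-partition {K = []} P-obj Z-part = μ-empty P-obj (λ x p → Any.¬Any[] (blocks-cover Z-part x p))
    μ-partition {P = P} {Z} {i ∷ K} P-obj Z-part@(record { blocks-disjoint = Zi#Z ∷ Z-disjoint }) = begin
      μ P                                          ≈⟨ μ-split P-obj Zi-def ⟩
      μ (P ∩ Z i) + μ P∖Zi                         ≈⟨ +-congˡ (μ-partition P∖Zi-obj P∖Zi-part) ⟩
      μ (P ∩ Z i) + sumL K (λ j → μ (P∖Zi ∩ Z j))  ≈⟨ +-congˡ (sumL-congAll (All.map removeZi Zi#Z)) ⟩
      μ (P ∩ Z i) + sumL K (λ j → μ (P ∩ Z j))     ∎
      where
      Zi-def = blocks-definable Z-part i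
      P∖Zi = P ∩ ∁ (Z i)
      P∖Zi-obj = obj-∩ P-obj (definable-∁ Zi-def)
      P∖Zi-part : IsPartition P∖Zi Z K
      P∖Zi-part = record
        { blocks-definable = blocks-definable Z-part
        ; blocks-disjoint  = Z-disjoint
        ; blocks-cover     = λ x (p , x∉Zi) → case blocks-cover Z-part x p of λ where
            (here x∈Zi) → ⊥-elim (x∉Zi x∈Zi)
            (there x∈Z) → x∈Z
        }
      removeZi : ∀ {j} → Disjoint 𝐌 (Z i) (Z j) → μ (P∖Zi ∩ Z j) ≈ μ (P ∩ Z j)
      removeZi {j} Zi#Zj = μ-cong (obj-∩ P∖Zi-obj (blocks-definable Z-part j))
        ((λ x ((p , _) , x∈Zj) → p , x∈Zj) , (λ x (p , x∈Zj) → (p , λ x∈Zi → Zi#Zj x x∈Zi x∈Zj) , x∈Zj))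

    levelSum-by-partition : ∀ {n} {J : Set} {Y : Pred 𝐌 n} {w K} {Z : J → Pred 𝐌 n} {Ks} (c : J → |A|) →
      Obj Y → IsPartition Y (levelSet Y w) K → IsPartition Y Z Ks → (∀ j → Z j ⊆′ Y) →
      (∀ j y → Z j y → w y ≈ c j) →
      levelSum 𝐌 C A S Y w K ≈ sumL Ks (λ j → c j * μ (Z j))
    levelSum-by-partition {Y = Y} {w} {K} {Z} {Ks} c Y-obj levels Z-part Z⊆Y w≈c = begin
      levelSum 𝐌 C A S Y w K                                  ≡⟨ levelSum≡sumL Y w K ⟩
      sumL K (λ a → a * μ (Lv a))                             ≈⟨ sumL-cong K (λ a → *-congˡ
                                                                   (μ-partition (Lv-obj a) (IsPartition-⊆ (λ _ → proj₁) Z-part))) ⟩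
      sumL K (λ a → a * sumL Ks (λ j → μ (Lv a ∩ Z j)))       ≈⟨ sumL-cong K (λ a → sumL-distribˡ Ks a _) ⟩
      sumL K (λ a → sumL Ks (λ j → a * μ (Lv a ∩ Z j)))       ≈⟨ sumL-cong K (λ a → sumL-cong Ks (reweight a)) ⟩
      sumL K (λ a → sumL Ks (λ j → c j * μ (Z j ∩ Lv a)))     ≈⟨ sumL-swap K Ks _ ⟩
      sumL Ks (λ j → sumL K (λ a → c j * μ (Z j ∩ Lv a)))     ≈⟨ sumL-cong Ks (λ j → sumL-distribˡ K (c j) _) ⟨
      sumL Ks (λ j → c j * sumL K (λ a → μ (Z j ∩ Lv a)))     ≈⟨ sumL-cong Ks (λ j → *-congˡ
                                                                   (μ-partition (Z-obj j) (IsPartition-⊆ (Z⊆Y j) levels))) ⟨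
      sumL Ks (λ j → c j * μ (Z j))                           ∎
      where
      Lv = levelSet Y w
      Lv-obj : ∀ a → Obj (Lv a)
      Lv-obj a = closed-sub Y-obj (blocks-definable levels a) (λ _ → proj₁)
      Z-obj : ∀ j → Obj (Z j)
      Z-obj j = closed-sub Y-obj (blocks-definable Z-part j) (Z⊆Y j)
      reweight : ∀ a j → a * μ (Lv a ∩ Z j) ≈ c j * μ (Z j ∩ Lv a)
      reweight a j = trans (μ-weight-cong Lv∩Z-obj (λ y ((_ , wy≈a) , y∈Zj) → trans (sym wy≈a) (w≈c j y y∈Zj)))
                           (*-congˡ (μ-∩-comm Lv∩Z-obj))
        where
        Lv∩Z-obj = obj-∩ (Lv-obj a) (blocks-definable Z-part j)

lemma2p2 :
    ExcludedMiddle 0ℓ →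
    (Σᴸ : Signature) (𝐌 : Structure Σᴸ) (A : CommutativeSemiring 0ℓ 0ℓ)
    (C : FullSubcat 𝐌) → HasObjWithTwoElements 𝐌 C →
    (S : SemiFubini 𝐌 C A) →
    {m n : ℕ} (X : Pred 𝐌 m) (Y : Pred 𝐌 n) →
    FullSubcat.Obj C X → FullSubcat.Obj C Y → (f : DefMap 𝐌 X Y) →
    (X₁ X₂ : Pred 𝐌 m) → Definable 𝐌 X₁ → Definable 𝐌 X₂ →
    _⊆_ 𝐌 X₁ X → _⊆_ 𝐌 X₂ X → Disjoint 𝐌 X₁ X₂ → _⊆_ 𝐌 X (_∪_ 𝐌 X₁ X₂) →
    IsLevelSum 𝐌 C A S Y (λ y → SemiFubini.μ S (λ x → fibre f y x × X₁ x))
      (SemiFubini.μ S X₁) →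
    IsLevelSum 𝐌 C A S Y (λ y → SemiFubini.μ S (λ x → fibre f y x × X₂ x))
      (SemiFubini.μ S X₂) →
    IsLevelSum∀ 𝐌 C A S Y (λ y → SemiFubini.μ S (fibre f y)) (SemiFubini.μ S X)
lemma2p2 em Σᴸ 𝐌 A C _ S {m} {n} X Y X-obj Y-obj f X₁ X₂ X₁-def X₂-def X₁⊆X X₂⊆X X₁#X₂ X⊆X₁∪X₂
         (L₁ , L₁-enum , μX₁≈) (L₂ , L₂-enum , μX₂≈) L L-enum = begin
  μ X                       ≈⟨ μ-∩-additive X-obj X₁-def X₂-def X₁#X₂ X⊆X₁∪X₂ ⟩
  μ (X ∩ X₁) + μ (X ∩ X₂)   ≈⟨ +-cong (μ-∩-⊆ X-obj X₁-def X₁⊆X) (μ-∩-⊆ X-obj X₂-def X₂⊆X) ⟩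
  μ X₁ + μ X₂               ≈⟨ +-cong (trans μX₁≈ (by-refinement proj₁ levels₁ (λ _ _ → proj₂ ∘ proj₁)))
                                      (trans μX₂≈ (by-refinement proj₂ levels₂ (λ _ _ → proj₂ ∘ proj₂))) ⟩
  weighted proj₁ + weighted proj₂
    ≈⟨ sumL-+ LL _ _ ⟨
  sumL LL (λ p → proj₁ p * μ (W p) + proj₂ p * μ (W p))
    ≈⟨ sumL-cong LL (λ p → distribʳ (μ (W p)) _ _) ⟨
  weighted (λ p → proj₁ p + proj₂ p)
    ≈⟨ by-refinement (λ p → proj₁ p + proj₂ p) levels v≈v₁+v₂ ⟨
  levelSum 𝐌 C A S Y v L    ∎
  where
  open FullSubcat C using (Obj)
  open CommutativeSemiring A renaming (Carrier to |A|)
  open SemiFubini S using (μ)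
  open FiniteSums A
  open Measure S
  open Classical em
  open import Relation.Binary.Reasoning.Setoid setoid

  v v₁ v₂ : Vec (Structure.M 𝐌) n → |A|
  v  y = μ (fibre f y)
  v₁ y = μ (fibre f y ∩ X₁)
  v₂ y = μ (fibre f y ∩ X₂)

  levels₁-def = restricted-levels-definable X-obj Y-obj f X₁-def X₁⊆X
  levels₂-def = restricted-levels-definable X-obj Y-obj f X₂-def X₂⊆X
  levels₁ = levels-partition levels₁-def L₁-enum
  levels₂ = levels-partition levels₂-def L₂-enum
  levels  = levels-partition (SemiFubini.F2 S (X-obj , Y-obj , f)) L-enum

  LL = cartesianProduct L₁ L₂
  W : |A| × |A| → Pred 𝐌 n
  W p = levelSet Y v₁ (proj₁ p) ∩ levelSet Y v₂ (proj₂ p)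

  weighted : (|A| × |A| → |A|) → |A|
  weighted c = sumL LL (λ p → c p * μ (W p))

  by-refinement : ∀ {w K} (c : |A| × |A| → |A|) → IsPartition Y (levelSet Y w) K →
                  (∀ p y → W p y → w y ≈ c p) → levelSum 𝐌 C A S Y w K ≈ weighted c
  by-refinement c levels-w = levelSum-by-partition c Y-obj levels-w
    (common-refinement levels₁-def L₁-enum levels₂-def L₂-enum) (λ _ _ → proj₁ ∘ proj₁)

  v≈v₁+v₂ : ∀ p y → W p y → v y ≈ proj₁ p + proj₂ p
  v≈v₁+v₂ p y ((_ , v₁y≈) , (_ , v₂y≈)) =
    trans (μ-fibre-additive X-obj f X₁-def X₂-def X₁#X₂ X⊆X₁∪X₂ y) (+-cong v₁y≈ v₂y≈)
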